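{- Let $G=(V,E)$ be an undirected graph with positive edge weights and $T\subseteq V$ a terminal set. If extreme sets $X$ and $Y$ cross, then at least one of $X\setminus Y$ or $Y\setminus X$ contains no terminal.
   Context: For $X\subseteq V$, $d(X)$ is the total weight of edges with exactly one endpoint in $X$. A Steiner cut is a set $X\subseteq V$ with $X\cap T\neq\emptyset$ and $T\not\subseteq X$. A Steiner cut $X$ is extreme if every Steiner cut $Y\subsetneq X$ satisfies $d(Y)>d(X)$. Two sets $X,Y$ cross if $X\cap Y$, $X\setminus Y$ and $Y\setminus X$ are all nonempty.
   Formalization: The edge weights of $G$ are positive rationals. -}

module Defs where

open import Data.Nat using (ℕ)
open import Data.Fin using (Fin)
open import Data.Fin.Subset using (Subset; _∈_; _∉_; _⊆_; _⊂_; _∩_; _─_; Nonempty)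
open import Data.Vec using (lookup)
open import Data.Bool using (Bool; true; false)
open import Data.List using (List; foldr; map; allFin)
open import Data.Rational using (ℚ; 0ℚ; _≤_; _<_; _+_)
open import Data.Product using (_×_)
open import Relation.Nullary using (¬_)
open import Relation.Binary.PropositionalEquality using (_≡_)

-- A weighted undirected graph on vertex set Fin n.
-- w i j is the weight of the edge {i,j}; w i j ≡ 0ℚ means "no edge",
-- otherwise the edge is present with (positive) weight w i j.
-- Loops (w i i) never contribute to any cut.
record WGraph (n : ℕ) : Set where
  field
    w        : Fin n → Fin n → ℚ
    w-sym    : ∀ i j → w i j ≡ w j i
    w-nonneg : ∀ i j → 0ℚ ≤ w i j

open WGraph public

pairCut : ∀ {n} → WGraph n → Subset n → Fin n → Fin n → ℚ
pairCut G X i j with lookup X i | lookup X j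
... | true  | false = w G i j
... | _     | _     = 0ℚ

sumℚ : List ℚ → ℚ
sumℚ = foldr _+_ 0ℚ

-- d(X): total weight of edges with exactly one endpoint in X.
-- Each such edge {i,j} is counted exactly once, via the ordered pair
-- (endpoint in X, endpoint outside X).
d : ∀ {n} → WGraph n → Subset n → ℚ
d {n} G X = sumℚ (map (λ i → sumℚ (map (λ j → pairCut G X i j) (allFin n))) (allFin n))

SteinerCut : ∀ {n} → Subset n → Subset n → Set
SteinerCut T X = Nonempty (X ∩ T) × ¬ (T ⊆ X)

Extreme : ∀ {n} → WGraph n → Subset n → Subset n → Set
Extreme G T X = SteinerCut T X × (∀ Y → Y ⊂ X → SteinerCut T Y → d G X < d G Y)

Cross : ∀ {n} → Subset n → Subset n → Set
Cross X Y = Nonempty (X ∩ Y) × Nonempty (X ─ Y) × Nonempty (Y ─ X)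

{-# OPTIONS --safe #-}
-- The cut function d is posimodular, d (X ─ Y) + d (Y ─ X) ≤ d X + d Y: matching the
-- ordered pair (i, j) counted for X ─ Y with (j, i) counted for Y ─ X, the inequality
-- already holds for each pair. If X ─ Y and Y ─ X both contained terminals, each would be a
-- Steiner cut (it contains a terminal and misses the one in the other difference), and
-- a proper subset of X resp. Y because X ∩ Y ≠ ∅. Extremality would then give
-- d X < d (X ─ Y) and d Y < d (Y ─ X), contradicting posimodularity.
module Submission where

open import Defs
open import Data.Nat using (ℕ; zero; suc)
open import Data.Fin.Subset using (Subset; _∩_; _─_; Empty; Nonempty; _∈_; _∉_; inside; outside)
open import Data.Sum using (_⊎_; inj₁; inj₂)

open import Data.Bool using (Bool; true; false; _∧_; not)
open import Data.Bool.Properties using (∧-zeroʳ; ∧-identityʳ)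
open import Data.Empty using (⊥-elim)
open import Data.Fin using (Fin; zero; suc)
open import Data.Fin.Subset.Properties
  using (nonempty?; ∩-comm; x∈p∩q⁻; p─q⊆p; p∩q≢∅⇒p─q⊂p)
open import Data.List using (tabulate; allFin; map)
open import Data.List.Properties using (map-tabulate)
open import Data.Product using (_,_; proj₁; proj₂)
open import Data.Rational using (ℚ; 0ℚ; _≤_; _<_; _+_)
open import Data.Rational.Properties
  using (≤-refl; ≤-reflexive; <-irrefl; <-≤-trans; +-comm; +-mono-≤; +-monoˡ-≤; +-monoʳ-≤;
         +-mono-<; +-0-commutativeMonoid; module ≤-Reasoning)
open import Data.Vec using (_∷_; lookup; here; there)
open import Algebra.Properties.CommutativeMonoid.Sum +-0-commutativeMonoid
  using (sum-syntax; sum-cong-≗; ∑-distrib-+; ∑-comm)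
open import Function using (_∘_; id)
open import Relation.Binary.PropositionalEquality
  using (_≡_; refl; sym; trans; cong; cong₂; subst; module ≡-Reasoning)
open import Relation.Nullary using (yes; no)

private
  variable
    n : ℕ

x∈p─q⇒x∉q : ∀ {x : Fin n} (p q : Subset n) → x ∈ p ─ q → x ∉ q
x∈p─q⇒x∉q (_ ∷ p) (_ ∷ q) (there x∈p─q) (there x∈q) = x∈p─q⇒x∉q p q x∈p─q x∈q

lookup-─ : ∀ (p q : Subset n) i → lookup (p ─ q) i ≡ lookup p i ∧ not (lookup q i)
lookup-─ (x ∷ p) (inside  ∷ q) zero    = sym (∧-zeroʳ x)
lookup-─ (x ∷ p) (outside ∷ q) zero    = sym (∧-identityʳ x)
lookup-─ (_ ∷ p) (_       ∷ q) (suc i) = lookup-─ p q i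

edgeCut : Bool → Bool → ℚ → ℚ
edgeCut true false w = w
edgeCut _    _     _ = 0ℚ

pairCut≡edgeCut : ∀ (G : WGraph n) X i j →
  pairCut G X i j ≡ edgeCut (lookup X i) (lookup X j) (w G i j)
pairCut≡edgeCut G X i j with lookup X i | lookup X j
... | true  | true  = refl
... | true  | false = refl
... | false | _     = refl

-- x, y say whether i ∈ X, i ∈ Y and x′, y′ whether j ∈ X, j ∈ Y, for an edge {i, j}.
edgeCut-posimodular : ∀ x y x′ y′ {w} → 0ℚ ≤ w →
  edgeCut (x ∧ not y) (x′ ∧ not y′) w + edgeCut (y′ ∧ not x′) (y ∧ not x) w
    ≤ edgeCut x x′ w + edgeCut y′ y w
edgeCut-posimodular true  true  true  true      _   = ≤-refl
edgeCut-posimodular true  true  true  false     _   = ≤-refl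
edgeCut-posimodular true  true  false true  {w} _   = ≤-reflexive (+-comm 0ℚ w)
edgeCut-posimodular true  true  false false     0≤w = +-monoˡ-≤ 0ℚ 0≤w
edgeCut-posimodular true  false true  true  {w} _   = ≤-reflexive (+-comm w 0ℚ)
edgeCut-posimodular true  false true  false     _   = ≤-refl
edgeCut-posimodular true  false false true      _   = ≤-refl
edgeCut-posimodular true  false false false     _   = ≤-refl
edgeCut-posimodular false true  true  true      _   = ≤-refl
edgeCut-posimodular false true  true  false     _   = ≤-refl
edgeCut-posimodular false true  false true      _   = ≤-refl
edgeCut-posimodular false true  false false     _   = ≤-refl
edgeCut-posimodular false false true  true      0≤w = +-monoʳ-≤ 0ℚ 0≤w
edgeCut-posimodular false false true  false     _   = ≤-refl
edgeCut-posimodular false false false true      _   = ≤-refl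
edgeCut-posimodular false false false false     _   = ≤-refl

pairCut-posimodular : ∀ (G : WGraph n) X Y i j →
  pairCut G (X ─ Y) i j + pairCut G (Y ─ X) j i ≤ pairCut G X i j + pairCut G Y j i
pairCut-posimodular G X Y i j
  rewrite pairCut≡edgeCut G (X ─ Y) i j | pairCut≡edgeCut G (Y ─ X) j i
        | pairCut≡edgeCut G X i j       | pairCut≡edgeCut G Y j i
        | lookup-─ X Y i | lookup-─ X Y j | lookup-─ Y X i | lookup-─ Y X j
        | w-sym G j i
  = edgeCut-posimodular (lookup X i) (lookup Y i) (lookup X j) (lookup Y j) (w-nonneg G i j)

∑-mono-≤ : ∀ {f g : Fin n → ℚ} → (∀ i → f i ≤ g i) → ∑[ i < n ] f i ≤ ∑[ i < n ] g i
∑-mono-≤ {zero}  _   = ≤-refl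
∑-mono-≤ {suc n} f≤g = +-mono-≤ (f≤g zero) (∑-mono-≤ (f≤g ∘ suc))

sumℚ-tabulate : ∀ (f : Fin n → ℚ) → sumℚ (tabulate f) ≡ ∑[ i < n ] f i
sumℚ-tabulate {zero}  f = refl
sumℚ-tabulate {suc n} f = cong (f zero +_) (sumℚ-tabulate (f ∘ suc))

sumℚ-allFin : ∀ (f : Fin n → ℚ) → sumℚ (map f (allFin n)) ≡ ∑[ i < n ] f i
sumℚ-allFin f = trans (cong sumℚ (map-tabulate id f)) (sumℚ-tabulate f)

d≡∑∑pairCut : ∀ (G : WGraph n) X → d G X ≡ ∑[ i < n ] ∑[ j < n ] pairCut G X i j
d≡∑∑pairCut {n} G X = begin
  sumℚ (map (λ i → sumℚ (map (pairCut G X i) (allFin n))) (allFin n))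
    ≡⟨ sumℚ-allFin (λ i → sumℚ (map (pairCut G X i) (allFin n))) ⟩
  ∑[ i < n ] sumℚ (map (pairCut G X i) (allFin n))
    ≡⟨ sum-cong-≗ (λ i → sumℚ-allFin (pairCut G X i)) ⟩
  ∑[ i < n ] ∑[ j < n ] pairCut G X i j ∎
  where open ≡-Reasoning

∑∑-distrib-+-transpose : ∀ (f g : Fin n → Fin n → ℚ) →
  ∑[ i < n ] ∑[ j < n ] (f i j + g j i)
    ≡ ∑[ i < n ] ∑[ j < n ] f i j + ∑[ i < n ] ∑[ j < n ] g i j
∑∑-distrib-+-transpose {n} f g = begin
  ∑[ i < n ] ∑[ j < n ] (f i j + g j i)
    ≡⟨ sum-cong-≗ (λ i → ∑-distrib-+ (f i) (λ j → g j i)) ⟩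
  ∑[ i < n ] (∑[ j < n ] f i j + ∑[ j < n ] g j i)
    ≡⟨ ∑-distrib-+ (λ i → ∑[ j < n ] f i j) (λ i → ∑[ j < n ] g j i) ⟩
  ∑[ i < n ] ∑[ j < n ] f i j + ∑[ i < n ] ∑[ j < n ] g j i
    ≡⟨ cong (∑[ i < n ] ∑[ j < n ] f i j +_) (∑-comm (λ i j → g j i)) ⟩
  ∑[ i < n ] ∑[ j < n ] f i j + ∑[ i < n ] ∑[ j < n ] g i j ∎
  where open ≡-Reasoning

d-posimodular : ∀ (G : WGraph n) X Y → d G (X ─ Y) + d G (Y ─ X) ≤ d G X + d G Y
d-posimodular {n} G X Y = begin
  d G (X ─ Y) + d G (Y ─ X)
    ≡⟨ cong₂ _+_ (d≡∑∑pairCut G (X ─ Y)) (d≡∑∑pairCut G (Y ─ X)) ⟩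
  ∑[ i < n ] ∑[ j < n ] pairCut G (X ─ Y) i j + ∑[ i < n ] ∑[ j < n ] pairCut G (Y ─ X) i j
    ≡⟨ ∑∑-distrib-+-transpose (pairCut G (X ─ Y)) (pairCut G (Y ─ X)) ⟨
  ∑[ i < n ] ∑[ j < n ] (pairCut G (X ─ Y) i j + pairCut G (Y ─ X) j i)
    ≤⟨ ∑-mono-≤ (λ i → ∑-mono-≤ (pairCut-posimodular G X Y i)) ⟩
  ∑[ i < n ] ∑[ j < n ] (pairCut G X i j + pairCut G Y j i)
    ≡⟨ ∑∑-distrib-+-transpose (pairCut G X) (pairCut G Y) ⟩
  ∑[ i < n ] ∑[ j < n ] pairCut G X i j + ∑[ i < n ] ∑[ j < n ] pairCut G Y i j
    ≡⟨ cong₂ _+_ (d≡∑∑pairCut G X) (d≡∑∑pairCut G Y) ⟨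
  d G X + d G Y ∎
  where open ≤-Reasoning

─-steinerCut : ∀ {T X Y : Subset n} →
  Nonempty ((X ─ Y) ∩ T) → Nonempty ((Y ─ X) ∩ T) → SteinerCut T (X ─ Y)
─-steinerCut {T = T} {X} {Y} X─Y∩T≠∅ (b , b∈Y─X∩T) =
  X─Y∩T≠∅ , λ T⊆X─Y → x∈p─q⇒x∉q Y X b∈Y─X (p─q⊆p X Y (T⊆X─Y b∈T))
  where
  b∈Y─X : b ∈ Y ─ X
  b∈Y─X = proj₁ (x∈p∩q⁻ (Y ─ X) T b∈Y─X∩T)
  b∈T : b ∈ T
  b∈T = proj₂ (x∈p∩q⁻ (Y ─ X) T b∈Y─X∩T)

mainTheorem2 : ∀ {n} (G : WGraph n) (T X Y : Subset n) →
    Extreme G T X → Extreme G T Y → Cross X Y →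
    Empty ((X ─ Y) ∩ T) ⊎ Empty ((Y ─ X) ∩ T)
mainTheorem2 G T X Y (_ , X-extreme) (_ , Y-extreme) (X∩Y≠∅ , _ , _)
  with nonempty? ((X ─ Y) ∩ T) | nonempty? ((Y ─ X) ∩ T)
... | no  X─Y∩T=∅ | _            = inj₁ X─Y∩T=∅
... | yes _        | no  Y─X∩T=∅ = inj₂ Y─X∩T=∅
... | yes X─Y∩T≠∅ | yes Y─X∩T≠∅ =
  ⊥-elim (<-irrefl refl (<-≤-trans (+-mono-< dX<d[X─Y] dY<d[Y─X]) (d-posimodular G X Y)))
  where
  dX<d[X─Y] : d G X < d G (X ─ Y)
  dX<d[X─Y] = X-extreme (X ─ Y) (p∩q≢∅⇒p─q⊂p X Y X∩Y≠∅) (─-steinerCut X─Y∩T≠∅ Y─X∩T≠∅)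
  dY<d[Y─X] : d G Y < d G (Y ─ X)
  dY<d[Y─X] = Y-extreme (Y ─ X) (p∩q≢∅⇒p─q⊂p Y X (subst Nonempty (∩-comm X Y) X∩Y≠∅))
                        (─-steinerCut Y─X∩T≠∅ X─Y∩T≠∅)
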